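{- Let $i$ be a positive integer and $c$ a scalar, and consider the algebra generated by $D$ and $U$ with the relation $DU-UD=cU^i$. Let $w$ be a word composed of $n$ letters $D$ and $m$ letters $U$, and let $B_w$ be the Ferrers board outlined by $w$. Then $$w=\sum_{k=0}^{n}c^k\,r_k^{(i)}(B_w)\,U^{m+(i-1)k}D^{n-k}.$$
   Context: For a word $w$ with $n$ letters $D$: for $1\le j\le n$ let $h_j$ be the number of letters $U$ occurring to the right of the $j$-th $D$ (counting from the left). Then $B_w$ is the Ferrers board with columns $1,\dots,n$ (left to right) of heights $h_1\ge\cdots\ge h_n\ge0$, all columns top-aligned, so that each row extends leftwards to column $1$. The $i$-rook number $r_k^{(i)}(B)$ of a Ferrers board $B$ (the $i$-row creation rule) is the number of ways to place $k$ rooks on $B$ one at a time, each in a column strictly to the left of the previously placed rook, no rook in a row already occupied by a rook, where each time a rook is placed in a cell, $i$ new rows are created in all columns strictly to the left of that rook (the row of the rook is split into $i+1$ rows: the rook keeps one, the other $i$ are new available rows). Equivalently, $r_k^{(i)}(B)=\sum_{n\ge a_1>a_2>\cdots>a_k\ge1}\ \prod_{t=1}^{k}\big(h_{a_t}+(i-1)(t-1)\big)$. -}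

module Defs where

open import Data.Nat using (ℕ; zero; suc) renaming (_+_ to _+ℕ_; _*_ to _*ℕ_; _∸_ to _∸ℕ_)
open import Data.List using (List; []; _∷_; reverse; upTo; map)
open import Algebra.Bundles using (Ring; Semiring)
import Algebra.Definitions.RawSemiring as RawSemiringDefs

data Letter : Set where
  D U : Letter

countD : List Letter → ℕ
countD []      = 0
countD (D ∷ w) = suc (countD w)
countD (U ∷ w) = countD w

countU : List Letter → ℕ
countU []      = 0
countU (D ∷ w) = countU w
countU (U ∷ w) = suc (countU w)

-- Column heights h_1, ..., h_n of the Ferrers board B_w (left to right):
-- h_j = number of U's to the right of the j-th D.
heights : List Letter → List ℕ
heights []      = []
heights (D ∷ w) = countU w ∷ heights w
heights (U ∷ w) = heights w

-- Auxiliary for the i-rook number.  rookAux i p hs k, where hs lists the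
-- still-available column heights from RIGHT to LEFT and p rooks were already
-- placed (to the right), sums over choices of k further columns (each strictly
-- left of the previous one) the product of (h + (i-1)·t') with t' the number of
-- rooks placed before the current one.
rookAux : ℕ → ℕ → List ℕ → ℕ → ℕ
rookAux i p hs       zero    = 1
rookAux i p []       (suc k) = 0
rookAux i p (h ∷ hs) (suc k) =
  (h +ℕ (i ∸ℕ 1) *ℕ p) *ℕ rookAux i (suc p) hs k +ℕ rookAux i p hs (suc k)

-- r_k^{(i)}(B) for the Ferrers board with column heights hs (left to right):
--   sum_{n ≥ a_1 > ... > a_k ≥ 1} prod_{t=1}^k (h_{a_t} + (i-1)(t-1)).
rookNumber : ℕ → ℕ → List ℕ → ℕ
rookNumber i k hs = rookAux i 0 (reverse hs) k

rookW : ℕ → ℕ → List Letter → ℕ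
rookW i k w = rookNumber i k (heights w)

module RingWords {a ℓ} (R : Ring a ℓ) where
  open Ring R public
  open RawSemiringDefs (Semiring.rawSemiring (Ring.semiring R)) public using (_^_; _×_)

  sumR : List Carrier → Carrier
  sumR []       = 0#
  sumR (x ∷ xs) = x + sumR xs

  evalWord : Carrier → Carrier → List Letter → Carrier
  evalWord d u []      = 1#
  evalWord d u (D ∷ w) = d * evalWord d u w
  evalWord d u (U ∷ w) = u * evalWord d u w

-- Prepending U multiplies
-- each term by U.  Prepending D rewrites each term r_k c^k U^a D^b, where a = m + (i-1)k and
-- m = #U(w), by D U^a = U^a D + a c U^(a+i-1): one part keeps k, the other raises it by one.
-- The coefficient collected at c^(k+1) is r_(k+1)(B_w) + (m + (i-1)k) r_k(B_w), which is
-- r_(k+1)(B_(Dw)): the new leftmost column has height m, and a rook placed in it comes last,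
-- after k rooks that each created i-1 rows.
module Submission where

open import Defs
open import Data.Nat using (ℕ; zero; suc; z≤n; s≤s; _≤_; _<_)
  renaming (_+_ to _+ℕ_; _*_ to _*ℕ_; _∸_ to _∸ℕ_)
import Data.Nat.Properties as ℕ
open import Data.Nat.Solver using (module +-*-Solver)
open import Data.List using (List; []; _∷_; _∷ʳ_; map; upTo; applyUpTo; reverse; length)
open import Data.List.Properties using (unfold-reverse; length-reverse)
open import Data.Fin using (toℕ)
open import Data.Fin.Properties using (toℕ≤pred[n])
open import Algebra.Bundles using (Ring; CommutativeMonoid)
open import Function using (id)
open import Relation.Binary.PropositionalEquality as ≡ using (_≡_; module ≡-Reasoning)

rookAux-∷ʳ : ∀ i p hs h k →
  rookAux i p (hs ∷ʳ h) (suc k) ≡ rookAux i p hs (suc k) +ℕ (h +ℕ (i ∸ℕ 1) *ℕ (p +ℕ k)) *ℕ rookAux i p hs k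
rookAux-∷ʳ i p [] h zero rewrite ℕ.+-identityʳ p = ℕ.+-identityʳ _
rookAux-∷ʳ i p [] h (suc k) =
  ≡.trans (ℕ.+-identityʳ _)
    (≡.trans (ℕ.*-zeroʳ (h +ℕ (i ∸ℕ 1) *ℕ p)) (≡.sym (ℕ.*-zeroʳ (h +ℕ (i ∸ℕ 1) *ℕ (p +ℕ suc k)))))
rookAux-∷ʳ i p (x ∷ hs) h zero =
  ≡.trans (≡.cong ((x +ℕ (i ∸ℕ 1) *ℕ p) *ℕ 1 +ℕ_) (rookAux-∷ʳ i p hs h zero))
    (≡.sym (ℕ.+-assoc ((x +ℕ (i ∸ℕ 1) *ℕ p) *ℕ 1) (rookAux i p hs 1) _))
rookAux-∷ʳ i p (x ∷ hs) h (suc k) = begin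
  X *ℕ rookAux i (suc p) (hs ∷ʳ h) (suc k) +ℕ rookAux i p (hs ∷ʳ h) (suc (suc k))
    ≡⟨ ≡.cong₂ (λ s t → X *ℕ s +ℕ t) (rookAux-∷ʳ i (suc p) hs h k) (rookAux-∷ʳ i p hs h (suc k)) ⟩
  X *ℕ (a +ℕ H (suc p +ℕ k) *ℕ b) +ℕ (c +ℕ H (p +ℕ suc k) *ℕ e)
    ≡⟨ ≡.cong (λ t → X *ℕ (a +ℕ H t *ℕ b) +ℕ (c +ℕ H (p +ℕ suc k) *ℕ e)) (≡.sym (ℕ.+-suc p k)) ⟩
  X *ℕ (a +ℕ H (p +ℕ suc k) *ℕ b) +ℕ (c +ℕ H (p +ℕ suc k) *ℕ e)
    ≡⟨ regroup X a (H (p +ℕ suc k)) b c e ⟩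
  (X *ℕ a +ℕ c) +ℕ H (p +ℕ suc k) *ℕ (X *ℕ b +ℕ e) ∎
  where
  open ≡-Reasoning
  open +-*-Solver
  X = x +ℕ (i ∸ℕ 1) *ℕ p
  H : ℕ → ℕ
  H t = h +ℕ (i ∸ℕ 1) *ℕ t
  a = rookAux i (suc p) hs (suc k)
  b = rookAux i (suc p) hs k
  c = rookAux i p hs (suc (suc k))
  e = rookAux i p hs (suc k)
  regroup : ∀ x a h b c e →
    x *ℕ (a +ℕ h *ℕ b) +ℕ (c +ℕ h *ℕ e) ≡ (x *ℕ a +ℕ c) +ℕ h *ℕ (x *ℕ b +ℕ e)
  regroup = solve 6 (λ x a h b c e →
    x :* (a :+ h :* b) :+ (c :+ h :* e) := (x :* a :+ c) :+ h :* (x :* b :+ e)) ≡.refl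

rookAux-vanish : ∀ i p hs k → length hs < k → rookAux i p hs k ≡ 0
rookAux-vanish i p []       (suc k) _            = ≡.refl
rookAux-vanish i p (h ∷ hs) (suc k) (s≤s |hs|<k) = begin
  X *ℕ rookAux i (suc p) hs k +ℕ rookAux i p hs (suc k)
    ≡⟨ ≡.cong₂ (λ s t → X *ℕ s +ℕ t) (rookAux-vanish i (suc p) hs k |hs|<k)
                                   (rookAux-vanish i p hs (suc k) (ℕ.m<n⇒m<1+n |hs|<k)) ⟩
  X *ℕ 0 +ℕ 0 ≡⟨ ℕ.+-identityʳ _ ⟩
  X *ℕ 0      ≡⟨ ℕ.*-zeroʳ X ⟩
  0           ∎
  where
  open ≡-Reasoning
  X = h +ℕ (i ∸ℕ 1) *ℕ p

length-heights : ∀ w → length (heights w) ≡ countD w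
length-heights []      = ≡.refl
length-heights (D ∷ w) = ≡.cong suc (length-heights w)
length-heights (U ∷ w) = length-heights w

rookW-vanish : ∀ i k w → countD w < k → rookW i k w ≡ 0
rookW-vanish i k w n<k =
  rookAux-vanish i 0 (reverse (heights w)) k
    (≡.subst (_< k) (≡.sym (≡.trans (length-reverse (heights w)) (length-heights w))) n<k)

rookW-D∷ : ∀ i k w →
  rookW i (suc k) (D ∷ w) ≡ rookW i (suc k) w +ℕ (countU w +ℕ (i ∸ℕ 1) *ℕ k) *ℕ rookW i k w
rookW-D∷ i k w =
  ≡.trans (≡.cong (λ hs → rookAux i 0 hs (suc k)) (unfold-reverse (countU w) (heights w)))
          (rookAux-∷ʳ i 0 (reverse (heights w)) (countU w) k)

m+n*o+n≡m+n*[1+o] : ∀ m n o → (m +ℕ n *ℕ o) +ℕ n ≡ m +ℕ n *ℕ suc o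
m+n*o+n≡m+n*[1+o] m n o =
  ≡.trans (ℕ.+-assoc m (n *ℕ o) n)
          (≡.cong (m +ℕ_) (≡.trans (ℕ.+-comm (n *ℕ o) n) (≡.sym (ℕ.*-suc n o))))

module _ {a ℓ} (M : CommutativeMonoid a ℓ) where
  open CommutativeMonoid M renaming (_∙_ to _+_; ε to 0#; ∙-congˡ to +-congˡ)
  open import Algebra.Properties.CommutativeMonoid.Sum M using (sum-syntax)
  open import Algebra.Solver.CommutativeMonoid M using (solve; _⊕_; _⊜_)
  open import Relation.Binary.Reasoning.Setoid setoid

  private
    x+y+[z+w]≈x+[z+y+w] : ∀ x y z w → (x + y) + (z + w) ≈ x + ((z + y) + w)
    x+y+[z+w]≈x+[z+y+w] = solve 4 (λ x y z w → (x ⊕ y) ⊕ (z ⊕ w) ⊜ x ⊕ ((z ⊕ y) ⊕ w)) refl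

  ∑-shift : ∀ n (f g : ℕ → Carrier) → f (suc n) ≈ 0# →
    ∑[ k < suc n ] (f (toℕ k) + g (toℕ k)) ≈ f 0 + ∑[ k < suc n ] (f (suc (toℕ k)) + g (toℕ k))
  ∑-shift zero f g f1≈0 = begin
    (f 0 + g 0) + 0#          ≈⟨ +-congˡ (trans (∙-congʳ f1≈0) (identityˡ 0#)) ⟨
    (f 0 + g 0) + (f 1 + 0#)  ≈⟨ x+y+[z+w]≈x+[z+y+w] (f 0) (g 0) (f 1) 0# ⟩
    f 0 + ((f 1 + g 0) + 0#)  ∎
  ∑-shift (suc n) f g f[2+n]≈0 = begin
    (f 0 + g 0) + ∑[ k < suc n ] (f (suc (toℕ k)) + g (suc (toℕ k)))
      ≈⟨ +-congˡ (∑-shift n (λ k → f (suc k)) (λ k → g (suc k)) f[2+n]≈0) ⟩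
    (f 0 + g 0) + (f 1 + ∑[ k < suc n ] (f (suc (suc (toℕ k))) + g (suc (toℕ k))))
      ≈⟨ x+y+[z+w]≈x+[z+y+w] (f 0) (g 0) (f 1) _ ⟩
    f 0 + ((f 1 + g 0) + ∑[ k < suc n ] (f (suc (suc (toℕ k))) + g (suc (toℕ k)))) ∎

module _ {r₁ r₂} (R : Ring r₁ r₂) where
  open RingWords R
  open import Algebra.Properties.Group +-group using (//-rightDividesˡ)
  open import Algebra.Properties.Semiring.Sum semiring using (sum-syntax; sum-cong-≋; *-distribˡ-sum)
  open import Algebra.Properties.Semiring.Mult semiring
    using (×-comm-*; ×-assoc-*; ×-congʳ; ×-congˡ; ×-homo-1; ×-homo-+; ×-assocˡ)
  open import Algebra.Properties.CommutativeMonoid.Mult +-commutativeMonoid using (×-distrib-+)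
  open import Algebra.Properties.Semiring.Exp semiring using (^-homo-*; ^-congʳ)
  open import Relation.Binary.Reasoning.Setoid setoid

  x-y≈z⇒x≈y+z : ∀ {x y z} → x - y ≈ z → x ≈ y + z
  x-y≈z⇒x≈y+z {x} {y} {z} x-y≈z = begin
    x           ≈⟨ //-rightDividesˡ y x ⟨
    (x - y) + y ≈⟨ +-congʳ x-y≈z ⟩
    z + y       ≈⟨ +-comm z y ⟩
    y + z       ∎

  x*y≈y*x⇒y*xz≈x*yz : ∀ {x y} → x * y ≈ y * x → ∀ z → y * (x * z) ≈ x * (y * z)
  x*y≈y*x⇒y*xz≈x*yz {x} {y} x*y≈y*x z = begin
    y * (x * z) ≈⟨ *-assoc y x z ⟨
    (y * x) * z ≈⟨ *-congʳ x*y≈y*x ⟨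
    (x * y) * z ≈⟨ *-assoc x y z ⟩
    x * (y * z) ∎

  x*y≈y*x⇒x^n*y≈y*x^n : ∀ {x y} → x * y ≈ y * x → ∀ n → x ^ n * y ≈ y * x ^ n
  x*y≈y*x⇒x^n*y≈y*x^n {x} {y} x*y≈y*x zero    = trans (*-identityˡ y) (sym (*-identityʳ y))
  x*y≈y*x⇒x^n*y≈y*x^n {x} {y} x*y≈y*x (suc n) = begin
    (x * x ^ n) * y ≈⟨ *-assoc x (x ^ n) y ⟩
    x * (x ^ n * y) ≈⟨ *-congˡ (x*y≈y*x⇒x^n*y≈y*x^n x*y≈y*x n) ⟩
    x * (y * x ^ n) ≈⟨ x*y≈y*x⇒y*xz≈x*yz x*y≈y*x (x ^ n) ⟨
    y * (x * x ^ n) ∎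

  x*[n×1]*y≈n×[x*y] : ∀ x n y → (x * (n × 1#)) * y ≈ n × (x * y)
  x*[n×1]*y≈n×[x*y] x n y = begin
    (x * (n × 1#)) * y ≈⟨ *-congʳ (×-comm-* n x 1#) ⟩
    (n × (x * 1#)) * y ≈⟨ *-congʳ (×-congʳ n (*-identityʳ x)) ⟩
    (n × x) * y        ≈⟨ ×-assoc-* n x y ⟩
    n × (x * y)        ∎

  sumR-map-applyUpTo : ∀ (g : ℕ → Carrier) f n →
    sumR (map g (applyUpTo f n)) ≡ ∑[ k < n ] g (f (toℕ k))
  sumR-map-applyUpTo g f zero    = ≡.refl
  sumR-map-applyUpTo g f (suc n) = ≡.cong (g (f 0) +_) (sumR-map-applyUpTo g (λ k → f (suc k)) n)

  module NormalOrder (j : ℕ) {c d u : Carrier}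
                     (c*u≈u*c : c * u ≈ u * c) (c*d≈d*c : c * d ≈ d * c)
                     (du-ud≈cu^i : d * u - u * d ≈ c * u ^ suc j) where

    d*u^n≈u^n*d+n×cu^[n+j] : ∀ n → d * u ^ n ≈ u ^ n * d + n × (c * u ^ (n +ℕ j))
    d*u^n≈u^n*d+n×cu^[n+j] zero = begin
      d * 1#       ≈⟨ *-identityʳ d ⟩
      d            ≈⟨ *-identityˡ d ⟨
      1# * d       ≈⟨ +-identityʳ (1# * d) ⟨
      1# * d + 0#  ∎
    d*u^n≈u^n*d+n×cu^[n+j] (suc n) = begin
      d * (u * u ^ n)
        ≈⟨ *-assoc d u (u ^ n) ⟨
      (d * u) * u ^ n
        ≈⟨ *-congʳ (x-y≈z⇒x≈y+z du-ud≈cu^i) ⟩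
      (u * d + c * u ^ suc j) * u ^ n
        ≈⟨ distribʳ (u ^ n) (u * d) (c * u ^ suc j) ⟩
      (u * d) * u ^ n + (c * u ^ suc j) * u ^ n
        ≈⟨ +-cong (*-assoc u d (u ^ n)) (*-assoc c (u ^ suc j) (u ^ n)) ⟩
      u * (d * u ^ n) + c * (u ^ suc j * u ^ n)
        ≈⟨ +-cong (*-congˡ (d*u^n≈u^n*d+n×cu^[n+j] n)) (*-congˡ u^[1+j]*u^n) ⟩
      u * (u ^ n * d + n × X) + c * (u * u ^ (n +ℕ j))
        ≈⟨ +-congʳ (distribˡ u (u ^ n * d) (n × X)) ⟩
      (u * (u ^ n * d) + u * (n × X)) + Y
        ≈⟨ +-congʳ (+-cong (sym (*-assoc u (u ^ n) d)) u*n×X) ⟩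
      ((u * u ^ n) * d + n × Y) + Y
        ≈⟨ +-assoc _ (n × Y) Y ⟩
      (u * u ^ n) * d + (n × Y + Y)
        ≈⟨ +-congˡ (+-comm (n × Y) Y) ⟩
      (u * u ^ n) * d + (Y + n × Y) ∎
      where
      X = c * u ^ (n +ℕ j)
      Y = c * u ^ (suc n +ℕ j)
      u^[1+j]*u^n : u ^ suc j * u ^ n ≈ u * u ^ (n +ℕ j)
      u^[1+j]*u^n = trans (sym (^-homo-* u (suc j) n)) (^-congʳ u (≡.cong suc (ℕ.+-comm j n)))
      u*n×X : u * (n × X) ≈ n × Y
      u*n×X = trans (×-comm-* n u X) (×-congʳ n (x*y≈y*x⇒y*xz≈x*yz c*u≈u*c (u ^ (n +ℕ j))))

    monomial : ℕ → ℕ → ℕ → Carrier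
    monomial k a b = c ^ k * (u ^ a * d ^ b)

    u*monomial : ∀ k a b → u * monomial k a b ≈ monomial k (suc a) b
    u*monomial k a b = begin
      u * (c ^ k * (u ^ a * d ^ b))
        ≈⟨ x*y≈y*x⇒y*xz≈x*yz (x*y≈y*x⇒x^n*y≈y*x^n c*u≈u*c k) (u ^ a * d ^ b) ⟩
      c ^ k * (u * (u ^ a * d ^ b))
        ≈⟨ *-congˡ (*-assoc u (u ^ a) (d ^ b)) ⟨
      c ^ k * ((u * u ^ a) * d ^ b) ∎

    d*monomial : ∀ k a b →
      d * monomial k a b ≈ monomial k a (suc b) + a × monomial (suc k) (a +ℕ j) b
    d*monomial k a b = begin
      d * (c ^ k * (u ^ a * d ^ b))
        ≈⟨ x*y≈y*x⇒y*xz≈x*yz (x*y≈y*x⇒x^n*y≈y*x^n c*d≈d*c k) _ ⟩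
      c ^ k * (d * (u ^ a * d ^ b))
        ≈⟨ *-congˡ (*-assoc d (u ^ a) (d ^ b)) ⟨
      c ^ k * ((d * u ^ a) * d ^ b)
        ≈⟨ *-congˡ (*-congʳ (d*u^n≈u^n*d+n×cu^[n+j] a)) ⟩
      c ^ k * ((u ^ a * d + a × (c * V)) * d ^ b)
        ≈⟨ *-congˡ (distribʳ (d ^ b) (u ^ a * d) (a × (c * V))) ⟩
      c ^ k * ((u ^ a * d) * d ^ b + (a × (c * V)) * d ^ b)
        ≈⟨ *-congˡ (+-cong (*-assoc (u ^ a) d (d ^ b)) (×-assoc-* a (c * V) (d ^ b))) ⟩
      c ^ k * (u ^ a * d ^ suc b + a × ((c * V) * d ^ b))
        ≈⟨ distribˡ (c ^ k) _ _ ⟩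
      monomial k a (suc b) + c ^ k * (a × ((c * V) * d ^ b))
        ≈⟨ +-congˡ (×-comm-* a (c ^ k) _) ⟩
      monomial k a (suc b) + a × (c ^ k * ((c * V) * d ^ b))
        ≈⟨ +-congˡ (×-congʳ a c^k*[cV*d^b]) ⟩
      monomial k a (suc b) + a × monomial (suc k) (a +ℕ j) b ∎
      where
      V = u ^ (a +ℕ j)
      c^k*[cV*d^b] : c ^ k * ((c * V) * d ^ b) ≈ monomial (suc k) (a +ℕ j) b
      c^k*[cV*d^b] = begin
        c ^ k * ((c * V) * d ^ b)  ≈⟨ *-congˡ (*-assoc c V (d ^ b)) ⟩
        c ^ k * (c * (V * d ^ b))  ≈⟨ *-assoc (c ^ k) c _ ⟨
        (c ^ k * c) * (V * d ^ b)  ≈⟨ *-congʳ (x*y≈y*x⇒x^n*y≈y*x^n refl k) ⟩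
        c ^ suc k * (V * d ^ b)    ∎

    term : List Letter → ℕ → Carrier
    term w k = rookW (suc j) k w × monomial k (countU w +ℕ j *ℕ k) (countD w ∸ℕ k)

    evalWord≈∑term : ∀ w → evalWord d u w ≈ ∑[ k < suc (countD w) ] term w (toℕ k)
    evalWord≈∑term [] = begin
      1#                                ≈⟨ ^-congʳ u (ℕ.*-zeroʳ j) ⟨
      u ^ (j *ℕ 0)                      ≈⟨ *-identityʳ _ ⟨
      u ^ (j *ℕ 0) * 1#                 ≈⟨ *-identityˡ _ ⟨
      monomial 0 (j *ℕ 0) 0             ≈⟨ ×-homo-1 _ ⟨
      1 × monomial 0 (j *ℕ 0) 0         ≈⟨ +-identityʳ _ ⟨
      1 × monomial 0 (j *ℕ 0) 0 + 0#    ∎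
    evalWord≈∑term (U ∷ w) = begin
      u * evalWord d u w
        ≈⟨ *-congˡ (evalWord≈∑term w) ⟩
      u * ∑[ k < suc (countD w) ] term w (toℕ k)
        ≈⟨ *-distribˡ-sum {suc (countD w)} u (λ k → term w (toℕ k)) ⟩
      ∑[ k < suc (countD w) ] (u * term w (toℕ k))
        ≈⟨ sum-cong-≋ {suc (countD w)} (λ k → u*term (toℕ k)) ⟩
      ∑[ k < suc (countD w) ] term (U ∷ w) (toℕ k) ∎
      where
      u*term : ∀ k → u * term w k ≈ term (U ∷ w) k
      u*term k = trans (×-comm-* r u (monomial k a b)) (×-congʳ r (u*monomial k a b))
        where
        r = rookW (suc j) k w
        a = countU w +ℕ j *ℕ k
        b = countD w ∸ℕ k
    evalWord≈∑term (D ∷ w) = begin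
      d * evalWord d u w
        ≈⟨ *-congˡ (evalWord≈∑term w) ⟩
      d * ∑[ k < suc n ] term w (toℕ k)
        ≈⟨ *-distribˡ-sum {suc n} d (λ k → term w (toℕ k)) ⟩
      ∑[ k < suc n ] (d * term w (toℕ k))
        ≈⟨ sum-cong-≋ {suc n} (λ k → d*term (toℕ k) (toℕ≤pred[n] k)) ⟩
      ∑[ k < suc n ] (A (toℕ k) + B (toℕ k))
        ≈⟨ ∑-shift +-commutativeMonoid n A B A[1+n]≈0 ⟩
      A 0 + ∑[ k < suc n ] (A (suc (toℕ k)) + B (toℕ k))
        ≈⟨ +-congˡ (sum-cong-≋ {suc n} (λ k → A[1+k]+B[k]≈term (toℕ k))) ⟩
      ∑[ k < suc (suc n) ] term (D ∷ w) (toℕ k) ∎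
      where
      n = countD w
      r : ℕ → ℕ
      r k = rookW (suc j) k w
      e : ℕ → ℕ
      e k = countU w +ℕ j *ℕ k
      A : ℕ → Carrier
      A k = r k × monomial k (e k) (suc n ∸ℕ k)
      B : ℕ → Carrier
      B k = r k × (e k × monomial (suc k) (e k +ℕ j) (n ∸ℕ k))

      d*term : ∀ k → k ≤ n → d * term w k ≈ A k + B k
      d*term k k≤n = begin
        d * term w k
          ≈⟨ ×-comm-* (r k) d _ ⟩
        r k × (d * monomial k (e k) (n ∸ℕ k))
          ≈⟨ ×-congʳ (r k) (d*monomial k (e k) (n ∸ℕ k)) ⟩
        r k × (monomial k (e k) (suc (n ∸ℕ k)) + e k × N)
          ≈⟨ ×-distrib-+ _ _ (r k) ⟩
        r k × monomial k (e k) (suc (n ∸ℕ k)) + B k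
          ≈⟨ +-congʳ (×-congʳ (r k) (*-congˡ (*-congˡ (^-congʳ d (ℕ.+-∸-assoc 1 k≤n))))) ⟨
        A k + B k ∎
        where
        N = monomial (suc k) (e k +ℕ j) (n ∸ℕ k)

      A[1+n]≈0 : A (suc n) ≈ 0#
      A[1+n]≈0 = ×-congˡ (rookW-vanish (suc j) (suc n) w (ℕ.n<1+n n))

      A[1+k]+B[k]≈term : ∀ k → A (suc k) + B k ≈ term (D ∷ w) (suc k)
      A[1+k]+B[k]≈term k = begin
        r (suc k) × M + r k × (e k × monomial (suc k) (e k +ℕ j) (n ∸ℕ k))
          ≈⟨ +-congˡ (×-congʳ (r k) (×-congʳ (e k) (*-congˡ (*-congʳ (^-congʳ u e[k]+j≡e[1+k]))))) ⟩
        r (suc k) × M + r k × (e k × M)   ≈⟨ +-congˡ (×-assocˡ M (r k) (e k)) ⟩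
        r (suc k) × M + (r k *ℕ e k) × M  ≈⟨ +-congˡ (×-congˡ (ℕ.*-comm (r k) (e k))) ⟩
        r (suc k) × M + (e k *ℕ r k) × M  ≈⟨ ×-homo-+ M (r (suc k)) (e k *ℕ r k) ⟨
        (r (suc k) +ℕ e k *ℕ r k) × M     ≈⟨ ×-congˡ (rookW-D∷ (suc j) k w) ⟨
        term (D ∷ w) (suc k)              ∎
        where
        M = monomial (suc k) (e (suc k)) (n ∸ℕ k)
        e[k]+j≡e[1+k] : e k +ℕ j ≡ e (suc k)
        e[k]+j≡e[1+k] = m+n*o+n≡m+n*[1+o] (countU w) j k

mainTheorem5 : ∀ {a ℓ} (R : Ring a ℓ) → let open RingWords R in
    (i : ℕ) → 1 ≤ i → (c d u : Carrier) →
    (∀ x → c * x ≈ x * c) →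
    d * u - u * d ≈ c * (u ^ i) →
    (w : List Letter) →
    evalWord d u w ≈
      sumR (map (λ k → ((c ^ k) * (rookW i k w × 1#)) * ((u ^ (countU w +ℕ (i ∸ℕ 1) *ℕ k)) * (d ^ (countD w ∸ℕ k))))
                (upTo (suc (countD w))))
mainTheorem5 R (suc j) (s≤s z≤n) c d u c-central du-ud≈cu^i w = begin
  evalWord d u w
    ≈⟨ evalWord≈∑term w ⟩
  ∑[ k < suc (countD w) ] term w (toℕ k)
    ≈⟨ sum-cong-≋ {suc (countD w)} (λ k → sym (summand≈term (toℕ k))) ⟩
  ∑[ k < suc (countD w) ] summand (toℕ k)
    ≡⟨ sumR-map-applyUpTo R summand id (suc (countD w)) ⟨
  sumR (map summand (upTo (suc (countD w)))) ∎
  where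
  open RingWords R
  open NormalOrder R j (c-central u) (c-central d) du-ud≈cu^i
  open import Algebra.Properties.Semiring.Sum semiring using (sum-syntax; sum-cong-≋)
  open import Relation.Binary.Reasoning.Setoid setoid
  summand : ℕ → Carrier
  summand k = ((c ^ k) * (rookW (suc j) k w × 1#)) * ((u ^ (countU w +ℕ j *ℕ k)) * (d ^ (countD w ∸ℕ k)))
  summand≈term : ∀ k → summand k ≈ term w k
  summand≈term k = x*[n×1]*y≈n×[x*y] R (c ^ k) (rookW (suc j) k w) _
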